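{- Let $n\ge1$, let $J\subseteq S_n^B=\{t,s_1,\ldots,s_{n-1}\}$, and write $x\sim_J y$ if $x,y$ lie in the same left coset of the parabolic subgroup $W_J$ of $B_n$ generated by $J$. Then for every $s\in S_n^B$ and all $x,v\in B_n$: if $vsx\sim_J x$ and $x\not\sim_J sx$, then $s\in\mathrm{rw}(v)$.
   Context: $B_n$ is realized as the group of signed permutations of $\{\pm1,\ldots,\pm n\}$ (bijections $w$ with $w(-i)=-w(i)$), generated by $t$ (swapping $1\leftrightarrow-1$, fixing the rest) and $s_i$ (swapping $i\leftrightarrow i+1$ and $-i\leftrightarrow-(i+1)$), $1\le i\le n-1$; permutations are multiplied right to left. $\mathrm{rw}(v)$ is the set of generators occurring in a reduced expression of $v$. -}

module Defs where

open import Data.Bool using (Bool; true; false; not; T)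
open import Data.Nat using (ℕ; suc; _≤_)
open import Data.Fin using (Fin; zero; suc; inject₁; _≟_)
open import Data.Product using (_×_; _,_; Σ; ∃)
open import Data.List using (List; []; _∷_; length)
open import Data.List.Relation.Unary.All using (All)
open import Data.List.Membership.Propositional using (_∈_)
open import Relation.Nullary using (yes; no)
open import Relation.Binary.PropositionalEquality using (_≡_)

-- Throughout, n = suc m (so n ≥ 1).
-- Signed points of {±1,…,±n}: (sign , index); sign true = negative.
-- Index k : Fin (suc m) stands for the number k+1.
SPt : ℕ → Set
SPt m = Bool × Fin (suc m)

neg : ∀ {m} → SPt m → SPt m
neg (b , i) = (not b , i)

IsSignedPerm : ∀ {m} → (SPt m → SPt m) → Set
IsSignedPerm {m} w =
  (∀ p → w (neg p) ≡ neg (w p)) ×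
  Σ (SPt m → SPt m) (λ w' → (∀ p → w' (w p) ≡ p) × (∀ p → w (w' p) ≡ p))

-- The Coxeter generators S_n^B = {t, s_1, …, s_{n-1}};
-- s k (k : Fin m) is s_{k+1}, swapping k+1 ↔ k+2 (and their negatives).
data Gen (m : ℕ) : Set where
  t : Gen m
  s : Fin m → Gen m

act : ∀ {m} → Gen m → SPt m → SPt m
act t (b , zero) = (not b , zero)
act t (b , suc i) = (b , suc i)
act (s k) (b , i) with i ≟ inject₁ k
... | yes _ = (b , suc k)
... | no _ with i ≟ suc k
...   | yes _ = (b , inject₁ k)
...   | no _ = (b , i)

-- Evaluation of a word g₁ g₂ … g_k as the product g₁ ∘ g₂ ∘ … ∘ g_k
-- (permutations multiplied right to left).
eval : ∀ {m} → List (Gen m) → SPt m → SPt m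
eval [] p = p
eval (g ∷ w) p = act g (eval w p)

_≈_ : ∀ {m} → (SPt m → SPt m) → (SPt m → SPt m) → Set
f ≈ g = ∀ p → f p ≡ g p

GenSet : ℕ → Set
GenSet m = Gen m → Bool

InParabolic : ∀ {m} → GenSet m → (SPt m → SPt m) → Set
InParabolic {m} J w = Σ (List (Gen m)) (λ u → All (λ g → T (J g)) u × (eval u ≈ w))

-- x ∼_J y : x and y lie in the same left coset x W_J = y W_J,
-- i.e. x⁻¹ y ∈ W_J, i.e. y = x ∘ u for some u ∈ W_J.
SameCoset : ∀ {m} → GenSet m → (SPt m → SPt m) → (SPt m → SPt m) → Set
SameCoset {m} J x y =
  Σ (List (Gen m)) (λ u → All (λ g → T (J g)) u × (y ≈ (λ p → x (eval u p))))

Reduced : ∀ {m} → List (Gen m) → (SPt m → SPt m) → Set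
Reduced {m} w v = (eval w ≈ v) × (∀ (w' : List (Gen m)) → eval w' ≈ v → length w ≤ length w')

InRw : ∀ {m} → Gen m → (SPt m → SPt m) → Set
InRw {m} g v = Σ (List (Gen m)) (λ w → Reduced w v × g ∈ w)

-- Label a signed point by its W_J-orbit: the J-block of its position, and its
-- sign unless t ∈ J and the block contains 1. A signed permutation lies in W_J
-- iff it preserves labels (generators of J preserve them; conversely a
-- label-preserving permutation can be sorted by generators of J), so
-- x ∼_J y iff ℓ = label ∘ x⁻¹ satisfies ℓ ∘ y = ℓ ∘ x.
-- Let w be a reduced word for v and suppose g ∉ w. Then v preserves the sets
-- Beyond g β (points of sign β, above the position of g when g = s_k), and g
-- moves exactly one point into each of them. By hypothesis ℓ is invariant under
-- v ∘ g; following the orbit of v ∘ g from the point that g moves in, which can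
-- only leave the set again through g, shows that ℓ is invariant under g itself,
-- i.e. x ∼_J g x.

module Submission where

open import Defs
open import Data.Bool using (Bool; true; false; not; T; _∧_; if_then_else_)
open import Data.Bool.Properties using (not-involutive; T-∧; T-≡) renaming (_≟_ to _≟ᵇ_)
open import Data.Empty using (⊥; ⊥-elim)
open import Data.Fin using (Fin; zero; suc; inject₁; _≟_; toℕ; fromℕ<; lower₁)
open import Data.Fin.Properties using (toℕ-inject₁; toℕ-injective; toℕ<n; toℕ-fromℕ<; fromℕ<-toℕ; inject₁-lower₁; all?; any?; pigeonhole)
open import Data.List using (List; []; _∷_; length; _++_; reverse)
open import Data.List.Properties using (unfold-reverse)
open import Data.List.Relation.Unary.All using (All; []; _∷_)
open import Data.List.Membership.Propositional using (_∈_)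
import Data.List.Relation.Unary.Any as Any
open Any using (here; there)
open import Data.Nat using (ℕ; zero; suc; _+_; _∸_; _≤_; _<_; z≤n; s≤s; s≤s⁻¹; _≤?_; _<?_; _≡ᵇ_)
open import Data.Nat.Properties using (≤-refl; ≤-reflexive; ≤-trans; <-trans; ≤-<-trans; <-≤-trans; n≤1+n; n<1+n; <⇒≤; <⇒≢; >⇒≢; n≮n; ≤⇒≯; ≮⇒≥; ≰⇒>; ≤∧≢⇒<; m≤n⇒m<n∨m≡n; m≤n⇒∃[o]m+o≡n; m<m+n; m≤n+m; m+[n∸m]≡n; +-suc; +-comm; +-identityʳ; suc-injective; ≡ᵇ⇒≡)
open import Data.Nat.GeneralisedArithmetic using (iterate)
open import Data.Product using (_×_; _,_; ∃; proj₁; proj₂)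
open import Data.Product.Properties using (≡-dec)
open import Data.Sum using (inj₁; inj₂)
open import Function using (_∘_)
open import Function.Bundles using (Equivalence)
open import Relation.Binary.Definitions using (DecidableEquality)
open import Relation.Binary.PropositionalEquality
open import Relation.Nullary using (¬_; Dec; yes; no; contradiction)
open import Relation.Nullary.Decidable using (map′; _×-dec_)

module _ {m : ℕ} where

  _≟ᵍ_ : DecidableEquality (Gen m)
  t ≟ᵍ t = yes refl
  t ≟ᵍ s _ = no λ ()
  s _ ≟ᵍ t = no λ ()
  s i ≟ᵍ s j with i ≟ j
  ... | yes refl = yes refl
  ... | no i≢j = no λ { refl → i≢j refl }

  _≟ₚ_ : DecidableEquality (SPt m)
  _≟ₚ_ = ≡-dec _≟ᵇ_ _≟_

  inject₁≢suc : (k : Fin m) → inject₁ k ≢ suc k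
  inject₁≢suc k e = <⇒≢ (n<1+n (toℕ k)) (trans (sym (toℕ-inject₁ k)) (cong toℕ e))

  act-s-inject₁ : ∀ (k : Fin m) b → act (s k) (b , inject₁ k) ≡ (b , suc k)
  act-s-inject₁ k b with inject₁ k ≟ inject₁ k
  ... | yes _ = refl
  ... | no k≢k = contradiction refl k≢k

  act-s-suc : ∀ (k : Fin m) b → act (s k) (b , suc k) ≡ (b , inject₁ k)
  act-s-suc k b with suc k ≟ inject₁ k
  ... | yes e = contradiction (sym e) (inject₁≢suc k)
  ... | no _ with suc k ≟ suc k
  ...   | yes _ = refl
  ...   | no k≢k = contradiction refl k≢k

  act-s-other : ∀ (k : Fin m) b i → i ≢ inject₁ k → i ≢ suc k → act (s k) (b , i) ≡ (b , i)
  act-s-other k b i i≢k i≢1+k with i ≟ inject₁ k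
  ... | yes e = contradiction e i≢k
  ... | no _ with i ≟ suc k
  ...   | yes e = contradiction e i≢1+k
  ...   | no _ = refl

  data SwapCase (k : Fin m) (b : Bool) (i : Fin (suc m)) : Set where
    lower-point : i ≡ inject₁ k → act (s k) (b , i) ≡ (b , suc k) → SwapCase k b i
    upper-point : i ≡ suc k → act (s k) (b , i) ≡ (b , inject₁ k) → SwapCase k b i
    other-point : i ≢ inject₁ k → i ≢ suc k → act (s k) (b , i) ≡ (b , i) → SwapCase k b i

  swapCase : ∀ (k : Fin m) b i → SwapCase k b i
  swapCase k b i with i ≟ inject₁ k
  ... | yes refl = lower-point refl (act-s-inject₁ k b)
  ... | no i≢k with i ≟ suc k
  ...   | yes refl = upper-point refl (act-s-suc k b)
  ...   | no i≢1+k = other-point i≢k i≢1+k (act-s-other k b i i≢k i≢1+k)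

  act-s-above : ∀ (k : Fin m) b i → suc (toℕ k) < toℕ i → act (s k) (b , i) ≡ (b , i)
  act-s-above k b i k+1<i with swapCase k b i
  ... | lower-point refl _ = contradiction (<-trans (n<1+n _) (subst (suc (toℕ k) <_) (toℕ-inject₁ k) k+1<i)) (n≮n (toℕ k))
  ... | upper-point refl _ = contradiction k+1<i (n≮n _)
  ... | other-point _ _ e = e

  act-s-sign : ∀ (k : Fin m) b i → proj₁ (act (s k) (b , i)) ≡ b
  act-s-sign k b i with swapCase k b i
  ... | lower-point _ e = cong proj₁ e
  ... | upper-point _ e = cong proj₁ e
  ... | other-point _ _ e = cong proj₁ e

  act-involutive : ∀ g (p : SPt m) → act g (act g p) ≡ p
  act-involutive t (b , zero) = cong (_, zero) (not-involutive b)
  act-involutive t (b , suc i) = refl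
  act-involutive (s k) (b , i) with swapCase k b i
  ... | lower-point refl e = trans (cong (act (s k)) e) (act-s-suc k b)
  ... | upper-point refl e = trans (cong (act (s k)) e) (act-s-inject₁ k b)
  ... | other-point _ _ e = trans (cong (act (s k)) e) e

  act-injective : ∀ g {p q : SPt m} → act g p ≡ act g q → p ≡ q
  act-injective g {p} {q} e = trans (sym (act-involutive g p)) (trans (cong (act g) e) (act-involutive g q))

  act-neg : ∀ g (p : SPt m) → act g (neg p) ≡ neg (act g p)
  act-neg t (b , zero) = refl
  act-neg t (b , suc i) = refl
  act-neg (s k) (b , i) with i ≟ inject₁ k
  ... | yes _ = refl
  ... | no _ with i ≟ suc k
  ...   | yes _ = refl
  ...   | no _ = refl

  eval-++ : ∀ (u w : List (Gen m)) p → eval (u ++ w) p ≡ eval u (eval w p)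
  eval-++ [] w p = refl
  eval-++ (g ∷ u) w p = cong (act g) (eval-++ u w p)

  eval-reverse : ∀ (w : List (Gen m)) p → eval w (eval (reverse w) p) ≡ p
  eval-reverse [] p = refl
  eval-reverse (g ∷ w) p = begin
    act g (eval w (eval (reverse (g ∷ w)) p))       ≡⟨ cong (λ u → act g (eval w (eval u p))) (unfold-reverse g w) ⟩
    act g (eval w (eval (reverse w ++ g ∷ []) p))   ≡⟨ cong (act g ∘ eval w) (eval-++ (reverse w) (g ∷ []) p) ⟩
    act g (eval w (eval (reverse w) (act g p)))     ≡⟨ cong (act g) (eval-reverse w (act g p)) ⟩
    act g (act g p)                                 ≡⟨ act-involutive g p ⟩
    p                                               ∎
    where open ≡-Reasoning

module SignedPerm {m : ℕ} {x : SPt m → SPt m} (x-perm : IsSignedPerm x) where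

  signed : ∀ p → x (neg p) ≡ neg (x p)
  signed = proj₁ x-perm

  inverse : SPt m → SPt m
  inverse = proj₁ (proj₂ x-perm)

  inverse-left : ∀ p → inverse (x p) ≡ p
  inverse-left = proj₁ (proj₂ (proj₂ x-perm))

  inverse-right : ∀ p → x (inverse p) ≡ p
  inverse-right = proj₂ (proj₂ (proj₂ x-perm))

  injective : ∀ {p q} → x p ≡ x q → p ≡ q
  injective {p} {q} e = trans (sym (inverse-left p)) (trans (cong inverse e) (inverse-left q))

  inverse-injective : ∀ {p q} → inverse p ≡ inverse q → p ≡ q
  inverse-injective {p} {q} e = trans (sym (inverse-right p)) (trans (cong x e) (inverse-right q))

  inverse-signed : ∀ p → inverse (neg p) ≡ neg (inverse p)
  inverse-signed p = begin
    inverse (neg p)               ≡⟨ cong (inverse ∘ neg) (sym (inverse-right p)) ⟩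
    inverse (neg (x (inverse p))) ≡⟨ cong inverse (sym (signed (inverse p))) ⟩
    inverse (x (neg (inverse p))) ≡⟨ inverse-left _ ⟩
    neg (inverse p)               ∎
    where open ≡-Reasoning

open SignedPerm using (inverse)

act∘-isSignedPerm : ∀ {m} g {x : SPt m → SPt m} → IsSignedPerm x → IsSignedPerm (act g ∘ x)
act∘-isSignedPerm g {x} x-perm =
  (λ p → trans (cong (act g) (X.signed p)) (act-neg g (x p))) ,
  X.inverse ∘ act g ,
  (λ p → trans (cong X.inverse (act-involutive g (x p))) (X.inverse-left p)) ,
  (λ p → trans (cong (act g) (X.inverse-right (act g p))) (act-involutive g p))
  where module X = SignedPerm x-perm

module _ {m : ℕ} (J : GenSet m) where

  -- joins i: the generator joining the points i+1 and i+2 lies in J.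
  joins : ℕ → Bool
  joins i with i <? m
  ... | yes i<m = J (s (fromℕ< i<m))
  ... | no _ = false

  joins-s : (k : Fin m) → joins (toℕ k) ≡ J (s k)
  joins-s k with toℕ k <? m
  ... | yes k<m = cong (J ∘ s) (fromℕ<-toℕ k k<m)
  ... | no k≮m = contradiction (toℕ<n k) k≮m

  blockStart : ℕ → ℕ
  blockStart zero = zero
  blockStart (suc i) = if joins i then blockStart i else suc i

  blockStart-≤ : ∀ i → blockStart i ≤ i
  blockStart-≤ zero = z≤n
  blockStart-≤ (suc i) with joins i
  ... | true = ≤-trans (blockStart-≤ i) (n≤1+n i)
  ... | false = ≤-refl

  blockStart-suc : ∀ i → blockStart i ≤ blockStart (suc i)
  blockStart-suc i with joins i
  ... | true = ≤-refl
  ... | false = ≤-trans (blockStart-≤ i) (n≤1+n i)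

  blockStart-mono : ∀ {a b} → a ≤ b → blockStart a ≤ blockStart b
  blockStart-mono {b = zero} z≤n = ≤-refl
  blockStart-mono {b = suc b} a≤1+b with m≤n⇒m<n∨m≡n a≤1+b
  ... | inj₁ a<1+b = ≤-trans (blockStart-mono (s≤s⁻¹ a<1+b)) (blockStart-suc b)
  ... | inj₂ refl = ≤-refl

  joins-within-block : ∀ {a b l} → blockStart a ≡ blockStart b → a ≤ l → l < b → T (joins l)
  joins-within-block {a} {b} {l} same a≤l l<b with joins l in eq
  ... | true = _
  ... | false = contradiction (≤-trans l+1≤start (≤-trans (≤-reflexive (sym same)) (blockStart-≤ a))) (≤⇒≯ a≤l)
    where
      l+1≤start : suc l ≤ blockStart b
      l+1≤start = subst (_≤ blockStart b) (cong (if_then blockStart l else suc l) eq) (blockStart-mono l<b)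

  s∈J-within-block : ∀ {a b} (l : Fin m) → blockStart a ≡ blockStart b → a ≤ toℕ l → toℕ l < b → T (J (s l))
  s∈J-within-block l same a≤l l<b = subst T (joins-s l) (joins-within-block same a≤l l<b)

  blockStart-s : (k : Fin m) → T (J (s k)) → blockStart (toℕ (suc k)) ≡ blockStart (toℕ (inject₁ k))
  blockStart-s k sk∈J rewrite joins-s k | toℕ-inject₁ k with J (s k)
  ... | true = refl

  -- Two signed points lie in the same W_J-orbit iff their labels agree: the block of
  -- J-connected positions, and the sign unless t ∈ J and the block is that of 1.
  blockLabel : Bool → ℕ → ℕ × Bool
  blockLabel b r = r , (if J t ∧ (r ≡ᵇ 0) then false else b)

  label : SPt m → ℕ × Bool
  label (b , i) = blockLabel b (blockStart (toℕ i))

  label-act : ∀ {g} → T (J g) → ∀ p → label (act g p) ≡ label p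
  label-act {t} t∈J (b , zero) with J t
  ... | true = refl
  label-act {t} _ (b , suc i) = refl
  label-act {s k} sk∈J (b , i) with swapCase k b i
  ... | lower-point refl e = trans (cong label e) (cong (blockLabel b) (blockStart-s k sk∈J))
  ... | upper-point refl e = trans (cong label e) (cong (blockLabel b) (sym (blockStart-s k sk∈J)))
  ... | other-point _ _ e = cong label e

  label-eval : ∀ {u} → All (T ∘ J) u → ∀ p → label (eval u p) ≡ label p
  label-eval [] p = refl
  label-eval (g∈J ∷ u∈J) p = trans (label-act g∈J _) (label-eval u∈J p)

  sign-flip⇒first-block : ∀ {r r′} → blockLabel true r ≡ blockLabel false r′ → T (J t) × r ≡ 0
  sign-flip⇒first-block {r} {r′} e with J t ∧ (r ≡ᵇ 0) in hidden | J t ∧ (r′ ≡ᵇ 0) | cong proj₂ e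
  ... | true | _ | _ = let t∈J , r≡ᵇ0 = Equivalence.to T-∧ (Equivalence.from T-≡ hidden) in t∈J , ≡ᵇ⇒≡ r 0 r≡ᵇ0
  ... | false | true | ()
  ... | false | false | ()

  record LabelPreserving (z : SPt m → SPt m) : Set where
    field
      signed : ∀ p → z (neg p) ≡ neg (z p)
      injective : ∀ {p q} → z p ≡ z q → p ≡ q
      preserves : ∀ p → label (z p) ≡ label p

  open LabelPreserving

  act∘-labelPreserving : ∀ {g z} → T (J g) → LabelPreserving z → LabelPreserving (act g ∘ z)
  act∘-labelPreserving {g} {z} g∈J zL = record
    { signed = λ p → trans (cong (act g) (signed zL p)) (act-neg g (z p))
    ; injective = injective zL ∘ act-injective g
    ; preserves = λ p → trans (label-act g∈J (z p)) (preserves zL p)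
    }

  inParabolic-unstep : ∀ {g z} → T (J g) → InParabolic J (act g ∘ z) → InParabolic J z
  inParabolic-unstep {g} {z} g∈J (u , u∈J , e) =
    g ∷ u , g∈J ∷ u∈J , λ p → trans (cong (act g) (e p)) (act-involutive g (z p))

  FixesFrom : ℕ → (SPt m → SPt m) → Set
  FixesFrom n z = ∀ l → n ≤ toℕ l → z (false , l) ≡ (false , l)

  act∘-fixesFrom : ∀ {n g z} → (∀ l → n ≤ toℕ l → act g (false , l) ≡ (false , l)) → FixesFrom n z → FixesFrom n (act g ∘ z)
  act∘-fixesFrom {g = g} g-fixes zF l n≤l = trans (cong (act g) (zF l n≤l)) (g-fixes l n≤l)

  fixesFrom-extend : ∀ {k z} → FixesFrom (suc (toℕ k)) z → z (false , k) ≡ (false , k) → FixesFrom (toℕ k) z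
  fixesFrom-extend {k} {z} zF zk l k≤l with m≤n⇒m<n∨m≡n k≤l
  ... | inj₁ k<l = zF l k<l
  ... | inj₂ k≡l = subst (λ i → z (false , i) ≡ (false , i)) (toℕ-injective k≡l) zk

  fixesFrom-zero⇒inParabolic : ∀ {z} → LabelPreserving z → FixesFrom 0 z → InParabolic J z
  fixesFrom-zero⇒inParabolic {z} zL zF = [] , [] , λ p → sym (fixes p)
    where
      fixes : ∀ p → z p ≡ p
      fixes (false , l) = zF l z≤n
      fixes (true , l) = trans (signed zL (false , l)) (cong neg (zF l z≤n))

  image-≤ : ∀ {k z β j} → LabelPreserving z → FixesFrom (suc (toℕ k)) z → z (false , k) ≡ (β , j) → toℕ j ≤ toℕ k
  image-≤ {k} {z} {β} {j} zL zF zk with toℕ j ≤? toℕ k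
  ... | yes j≤k = j≤k
  ... | no j≰k = ⊥-elim (collision β zk)
    where
      j-fixed : z (false , j) ≡ (false , j)
      j-fixed = zF j (≰⇒> j≰k)
      collision : ∀ β → z (false , k) ≡ (β , j) → ⊥
      collision false e = <⇒≢ (≰⇒> j≰k) (cong (toℕ ∘ proj₂) (injective zL (trans e (sym j-fixed))))
      collision true e with injective zL (trans e (sym (trans (signed zL (false , j)) (cong neg j-fixed))))
      ... | ()

  -- Sorting step: generators of J bring z (false , k) back to (false , k), by
  -- raising it through its block, or, if its sign is wrong, lowering it to the
  -- point 1, flipping it with t, and raising it again.
  module _ (k : Fin (suc m)) (fixesFrom-k : ∀ z → LabelPreserving z → FixesFrom (toℕ k) z → InParabolic J z) where

    label-image : ∀ {z q} → LabelPreserving z → z (false , k) ≡ q → label q ≡ label (false , k)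
    label-image zL zk = trans (cong label (sym zk)) (preserves zL (false , k))

    raise : ∀ d z j → LabelPreserving z → FixesFrom (suc (toℕ k)) z →
            z (false , k) ≡ (false , j) → toℕ j + d ≡ toℕ k → InParabolic J z
    raise zero z j zL zF zk j≡k = fixesFrom-k z zL (fixesFrom-extend {z = z} zF (trans zk (cong (false ,_) j≡k′)))
      where
        j≡k′ : j ≡ k
        j≡k′ = toℕ-injective (trans (sym (+-identityʳ (toℕ j))) j≡k)
    raise (suc d) z j zL zF zk j+d≡k with lower₁ j (>⇒≢ j<m) | inject₁-lower₁ j (>⇒≢ j<m)
      where
        j<m : toℕ j < m
        j<m = <-≤-trans (subst (toℕ j <_) j+d≡k (m<m+n (toℕ j) (s≤s z≤n))) (s≤s⁻¹ (toℕ<n k))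
    ... | j′ | refl =
      inParabolic-unstep sj′∈J (raise d (act (s j′) ∘ z) (suc j′) (act∘-labelPreserving sj′∈J zL)
        (act∘-fixesFrom {z = z} (λ l k<l → act-s-above j′ false l (≤-<-trans j′<k k<l)) zF)
        (trans (cong (act (s j′)) zk) (act-s-inject₁ j′ false))
        (trans (sym (+-suc (toℕ j′) d)) j′+d≡k))
      where
        j′+d≡k : toℕ j′ + suc d ≡ toℕ k
        j′+d≡k = trans (cong (_+ suc d) (sym (toℕ-inject₁ j′))) j+d≡k
        j′<k : toℕ j′ < toℕ k
        j′<k = subst (toℕ j′ <_) j′+d≡k (m<m+n (toℕ j′) (s≤s z≤n))
        sj′∈J : T (J (s j′))
        sj′∈J = s∈J-within-block j′ (cong proj₁ (label-image zL zk))
                  (≤-reflexive (toℕ-inject₁ j′)) j′<k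

    lower : ∀ e z j → LabelPreserving z → FixesFrom (suc (toℕ k)) z →
            z (false , k) ≡ (true , j) → toℕ j ≡ e → toℕ j ≤ toℕ k → InParabolic J z
    lower _ z zero zL zF zk _ _ =
      inParabolic-unstep t∈J (raise (toℕ k) (act t ∘ z) zero (act∘-labelPreserving t∈J zL)
        (act∘-fixesFrom {g = t} {z = z} t-fixes zF) (cong (act t) zk) refl)
      where
        t∈J : T (J t)
        t∈J = proj₁ (sign-flip⇒first-block (label-image zL zk))
        t-fixes : ∀ l → suc (toℕ k) ≤ toℕ l → act t (false , l) ≡ (false , l)
        t-fixes (suc l) _ = refl
    lower (suc e) z (suc j) zL zF zk j≡e j≤k =
      inParabolic-unstep sj∈J (lower e (act (s j) ∘ z) (inject₁ j) (act∘-labelPreserving sj∈J zL)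
        (act∘-fixesFrom {z = z} (λ l k<l → act-s-above j false l (≤-<-trans j≤k k<l)) zF)
        (trans (cong (act (s j)) zk) (act-s-suc j true))
        (trans (toℕ-inject₁ j) (suc-injective j≡e))
        (≤-trans (≤-reflexive (toℕ-inject₁ j)) (≤-trans (n≤1+n _) j≤k)))
      where
        sj∈J : T (J (s j))
        sj∈J = s∈J-within-block j (sym (proj₂ (sign-flip⇒first-block (label-image zL zk)))) z≤n ≤-refl
    lower zero z (suc j) _ _ _ ()

    fixesFrom-suc : ∀ z → LabelPreserving z → FixesFrom (suc (toℕ k)) z → InParabolic J z
    fixesFrom-suc z zL zF with z (false , k) in zk
    ... | false , j = raise (toℕ k ∸ toℕ j) z j zL zF zk (m+[n∸m]≡n (image-≤ zL zF zk))
    ... | true , j = lower (toℕ j) z j zL zF zk refl (image-≤ zL zF zk)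

  fixesFrom⇒inParabolic : ∀ n → n ≤ suc m → ∀ z → LabelPreserving z → FixesFrom n z → InParabolic J z
  fixesFrom⇒inParabolic zero _ z zL zF = fixesFrom-zero⇒inParabolic zL zF
  fixesFrom⇒inParabolic (suc n) n<1+m z zL zF =
    fixesFrom-suc (fromℕ< n<1+m) fixesFrom-n z zL (subst (λ i → FixesFrom (suc i) z) (sym (toℕ-fromℕ< n<1+m)) zF)
    where
      fixesFrom-n : ∀ z → LabelPreserving z → FixesFrom (toℕ (fromℕ< n<1+m)) z → InParabolic J z
      fixesFrom-n z zL zF = fixesFrom⇒inParabolic n (<⇒≤ n<1+m) z zL (subst (λ i → FixesFrom i z) (toℕ-fromℕ< n<1+m) zF)

  labelPreserving⇒inParabolic : ∀ {z} → LabelPreserving z → InParabolic J z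
  labelPreserving⇒inParabolic {z} zL = fixesFrom⇒inParabolic (suc m) ≤-refl z zL λ l 1+m≤l → contradiction (toℕ<n l) (≤⇒≯ 1+m≤l)

  sameCoset⇒labelInvariant : ∀ {x y} (x-perm : IsSignedPerm x) → SameCoset J y x →
                             ∀ p → label (inverse x-perm (y p)) ≡ label p
  sameCoset⇒labelInvariant {x} {y} x-perm (u , u∈J , x≈yu) p = begin
    label (inverse x-perm (y p))                         ≡⟨ cong (label ∘ inverse x-perm) y≡xu⁻¹ ⟩
    label (inverse x-perm (x (eval (reverse u) p)))      ≡⟨ cong label (SignedPerm.inverse-left x-perm _) ⟩
    label (eval (reverse u) p)                           ≡⟨ sym (label-eval u∈J _) ⟩
    label (eval u (eval (reverse u) p))                  ≡⟨ cong label (eval-reverse u p) ⟩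
    label p                                              ∎
    where
      open ≡-Reasoning
      y≡xu⁻¹ : y p ≡ x (eval (reverse u) p)
      y≡xu⁻¹ = sym (trans (x≈yu _) (cong y (eval-reverse u p)))

  labelInvariant⇒sameCoset : ∀ {x y} (x-perm : IsSignedPerm x) → IsSignedPerm y →
                             (∀ p → label (inverse x-perm (y p)) ≡ label p) → SameCoset J x y
  labelInvariant⇒sameCoset {x} {y} x-perm y-perm invariant =
    let u , u∈J , e = labelPreserving⇒inParabolic x⁻¹y-preserving
    in u , u∈J , λ p → trans (sym (X.inverse-right (y p))) (cong x (sym (e p)))
    where
      module X = SignedPerm x-perm
      module Y = SignedPerm y-perm
      x⁻¹y-preserving : LabelPreserving (inverse x-perm ∘ y)
      x⁻¹y-preserving = record
        { signed = λ p → trans (cong (inverse x-perm) (Y.signed p)) (X.inverse-signed (y p))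
        ; injective = Y.injective ∘ X.inverse-injective
        ; preserves = invariant
        }

module _ {X : Set} (h : X → X) where

  iterate-comm : ∀ x n → iterate h (h x) n ≡ h (iterate h x n)
  iterate-comm x zero = refl
  iterate-comm x (suc n) = iterate-comm (h x) n

  iterate-+ : ∀ x k l → iterate h x (k + l) ≡ iterate h (iterate h x k) l
  iterate-+ x zero l = refl
  iterate-+ x (suc k) l = iterate-+ (h x) k l

  iterate-cancel : (∀ {p q} → h p ≡ h q → p ≡ q) → ∀ {p q} n → iterate h p n ≡ iterate h q n → p ≡ q
  iterate-cancel h-injective zero e = e
  iterate-cancel h-injective (suc n) e = h-injective (iterate-cancel h-injective n e)

  iterate-invariant : ∀ {A : Set} (f : X → A) → (∀ q → f (h q) ≡ f q) → ∀ x n → f (iterate h x n) ≡ f x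
  iterate-invariant f invariant x zero = refl
  iterate-invariant f invariant x (suc n) = trans (iterate-invariant f invariant (h x) n) (invariant x)

  -- If a enters P, P can only be left through b, and P is finite, then the
  -- forward orbit of a reaches b: otherwise it would return to a inside P.
  orbit-reaches : DecidableEquality X → (∀ {p q} → h p ≡ h q → p ≡ q) →
                  (P : X → Set) {n : ℕ} (code : X → Fin n) → (∀ {p q} → P p → P q → code p ≡ code q → p ≡ q) →
                  ∀ {a b} → ¬ P a → P (h a) → (∀ q → P q → q ≢ b → P (h q)) → ∃ λ i → iterate h (h a) i ≡ b
  orbit-reaches _≟ₓ_ h-injective P {n} code code-injective {a} {b} ¬Pa Pha P-closed
    with any? (λ (i : Fin (suc n)) → iterate h (h a) (toℕ i) ≟ₓ b)
  ... | yes (i , e) = toℕ i , e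
  ... | no never =
    let i , j , i<j , same-code = pigeonhole (n<1+n n) (code ∘ orbit ∘ toℕ)
    in contradiction (returns (toℕ i) (toℕ j) i<j (s≤s⁻¹ (toℕ<n j)) same-code) ¬Pa
    where
      orbit : ℕ → X
      orbit = iterate h (h a)

      avoids : ∀ i → i ≤ n → orbit i ≢ b
      avoids i i≤n e = never (fromℕ< (s≤s i≤n) , trans (cong orbit (toℕ-fromℕ< (s≤s i≤n))) e)

      stays : ∀ i → i ≤ n → P (orbit i)
      stays zero _ = Pha
      stays (suc i) i<n = subst P (sym (iterate-comm (h a) i)) (P-closed _ (stays i (<⇒≤ i<n)) (avoids i (<⇒≤ i<n)))

      returns : ∀ i j → i < j → j ≤ n → code (orbit i) ≡ code (orbit j) → P a
      returns i j i<j j≤n same-code with m≤n⇒∃[o]m+o≡n i<j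
      ... | o , refl = subst P (sym a-periodic) (stays o (≤-trans (m≤n+m o (suc i)) j≤n))
        where
          a-periodic : a ≡ iterate h a (suc o)
          a-periodic = iterate-cancel h-injective (suc i) (begin
            iterate h a (suc i)                      ≡⟨ code-injective (stays i (<⇒≤ (<-≤-trans i<j j≤n))) (stays j j≤n) same-code ⟩
            iterate h a (suc (suc i + o))            ≡⟨ cong (iterate h a ∘ suc) (trans (cong suc (+-comm i o)) (sym (+-suc o i))) ⟩
            iterate h a (suc o + suc i)              ≡⟨ iterate-+ a (suc o) (suc i) ⟩
            iterate h (iterate h a (suc o)) (suc i)  ∎)
            where open ≡-Reasoning

module _ {m : ℕ} where

  -- The parabolic subgroup generated by S ∖ {g} keeps each of these sets
  -- (indexed by a sign β) invariant; g moves the point outside g β into it.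
  Beyond : Gen m → Bool → SPt m → Set
  Beyond t β (b , _) = b ≡ β
  Beyond (s k) β (b , i) = b ≡ β × toℕ k < toℕ i

  outside inside : Gen m → Bool → SPt m
  outside t β = not β , zero
  outside (s k) β = β , inject₁ k
  inside t β = β , zero
  inside (s k) β = β , suc k

  act-outside : ∀ g β → act g (outside g β) ≡ inside g β
  act-outside t β = cong (_, zero) (not-involutive β)
  act-outside (s k) β = act-s-inject₁ k β

  outside-not-beyond : ∀ g β → ¬ Beyond g β (outside g β)
  outside-not-beyond t false ()
  outside-not-beyond t true ()
  outside-not-beyond (s k) β (_ , k<k) = n≮n (toℕ k) (subst (toℕ k <_) (toℕ-inject₁ k) k<k)

  inside-beyond : ∀ g β → Beyond g β (inside g β)
  inside-beyond t β = refl
  inside-beyond (s k) β = refl , n<1+n (toℕ k)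

  act-fixes-beyond : ∀ g β q → Beyond g β q → q ≢ inside g β → act g q ≡ q
  act-fixes-beyond t β (b , zero) refl q≢inside = contradiction refl q≢inside
  act-fixes-beyond t β (b , suc i) _ _ = refl
  act-fixes-beyond (s k) β (b , i) (refl , k<i) q≢inside with swapCase k b i
  ... | lower-point refl _ = contradiction (refl , k<i) (outside-not-beyond (s k) b)
  ... | upper-point refl _ = contradiction refl q≢inside
  ... | other-point _ _ e = e

  beyond-injective : ∀ {g β p q} → Beyond g β p → Beyond g β q → proj₂ p ≡ proj₂ q → p ≡ q
  beyond-injective {t} {p = b , _} {_ , _} refl refl = cong (b ,_)
  beyond-injective {s k} {p = b , _} {_ , _} (refl , _) (refl , _) = cong (b ,_)

  act-preserves-beyond : ∀ {g g′} β q → g′ ≢ g → Beyond g β q → Beyond g β (act g′ q)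
  act-preserves-beyond {t} {t} _ _ g′≢g _ = contradiction refl g′≢g
  act-preserves-beyond {t} {s j} β (b , i) _ b≡β = trans (act-s-sign j b i) b≡β
  act-preserves-beyond {s k} {t} β (b , suc i) _ q-beyond = q-beyond
  act-preserves-beyond {s k} {s j} β (b , i) sj≢sk (b≡β , k<i) with swapCase j b i
  ... | lower-point refl e = subst (Beyond (s k) β) (sym e) (b≡β , <-trans (subst (toℕ k <_) (toℕ-inject₁ j) k<i) (n<1+n _))
  ... | upper-point refl e = subst (Beyond (s k) β) (sym e) (b≡β , subst (toℕ k <_) (sym (toℕ-inject₁ j)) k<j)
    where
      k<j : toℕ k < toℕ j
      k<j = ≤∧≢⇒< (s≤s⁻¹ k<i) (λ k≡j → sj≢sk (cong s (sym (toℕ-injective k≡j))))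
  ... | other-point _ _ e = subst (Beyond (s k) β) (sym e) (b≡β , k<i)

  eval-preserves-beyond : ∀ {g} w → ¬ g ∈ w → ∀ β q → Beyond g β q → Beyond g β (eval w q)
  eval-preserves-beyond [] _ β q q-beyond = q-beyond
  eval-preserves-beyond (g′ ∷ w) g∉g′∷w β q q-beyond =
    act-preserves-beyond β _ (λ g′≡g → g∉g′∷w (here (sym g′≡g)))
      (eval-preserves-beyond w (g∉g′∷w ∘ there) β q q-beyond)

  module _ {A : Set} (lam : SPt m → A) {v : SPt m → SPt m} (v-injective : ∀ {p q} → v p ≡ v q → p ≡ q) where

    inside≡outside : ∀ g → (∀ β q → Beyond g β q → Beyond g β (v q)) → (∀ q → lam (v (act g q)) ≡ lam q) →
                     ∀ β → lam (inside g β) ≡ lam (outside g β)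
    inside≡outside g v-beyond vg-invariant β =
      let i , reaches = orbit-reaches h _≟ₚ_ (act-injective g ∘ v-injective) (Beyond g β) proj₂ beyond-injective
                          (outside-not-beyond g β) enters closed
      in begin
      lam (inside g β)                      ≡⟨ cong lam (sym reaches) ⟩
      lam (iterate h (h (outside g β)) i)   ≡⟨ iterate-invariant h lam vg-invariant (h (outside g β)) i ⟩
      lam (h (outside g β))                 ≡⟨ vg-invariant (outside g β) ⟩
      lam (outside g β)                     ∎
      where
        open ≡-Reasoning
        h : SPt m → SPt m
        h = v ∘ act g
        enters : Beyond g β (h (outside g β))
        enters = subst (Beyond g β ∘ v) (sym (act-outside g β)) (v-beyond β _ (inside-beyond g β))
        closed : ∀ q → Beyond g β q → q ≢ inside g β → Beyond g β (h q)
        closed q q-beyond q≢inside =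
          v-beyond β (act g q) (subst (Beyond g β) (sym (act-fixes-beyond g β q q-beyond q≢inside)) q-beyond)

    generator-invariant : ∀ g → (∀ β q → Beyond g β q → Beyond g β (v q)) → (∀ q → lam (v (act g q)) ≡ lam q) →
                          ∀ q → lam (act g q) ≡ lam q
    generator-invariant t v-beyond vg-invariant (b , zero) = sym (inside≡outside t v-beyond vg-invariant b)
    generator-invariant t v-beyond vg-invariant (b , suc i) = refl
    generator-invariant (s k) v-beyond vg-invariant (b , i) with swapCase k b i
    ... | lower-point refl e = trans (cong lam e) (inside≡outside (s k) v-beyond vg-invariant b)
    ... | upper-point refl e = trans (cong lam e) (sym (inside≡outside (s k) v-beyond vg-invariant b))
    ... | other-point _ _ e = cong lam e

module _ {m : ℕ} where

  allGens : GenSet m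
  allGens _ = true

  blockStart-allGens : ∀ i → i ≤ m → blockStart allGens i ≡ 0
  blockStart-allGens zero _ = refl
  blockStart-allGens (suc i) i<m with i <? m
  ... | yes _ = blockStart-allGens i (<⇒≤ i<m)
  ... | no i≮m = contradiction i<m i≮m

  label-allGens : ∀ p → label allGens p ≡ (0 , false)
  label-allGens (b , i) rewrite blockStart-allGens (toℕ i) (s≤s⁻¹ (toℕ<n i)) = refl

  isSignedPerm⇒word : ∀ {v} → IsSignedPerm v → InParabolic allGens v
  isSignedPerm⇒word {v} v-perm = labelPreserving⇒inParabolic allGens record
    { signed = V.signed
    ; injective = V.injective
    ; preserves = λ p → trans (label-allGens (v p)) (sym (label-allGens p))
    }
    where module V = SignedPerm v-perm

  ∃-gen? : {R : Gen m → Set} → (∀ g → Dec (R g)) → Dec (∃ R)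
  ∃-gen? R? with R? t | any? (R? ∘ s)
  ... | yes r | _ = yes (t , r)
  ... | no _ | yes (k , r) = yes (s k , r)
  ... | no ¬rt | no ¬rs = no λ { (t , r) → ¬rt r ; (s k , r) → ¬rs (k , r) }

  ∀-spt? : {Q : SPt m → Set} → (∀ p → Dec (Q p)) → Dec (∀ p → Q p)
  ∀-spt? Q? = map′ (λ { (Qf , Qt) (false , i) → Qf i ; (Qf , Qt) (true , i) → Qt i })
                   (λ Qall → Qall ∘ (false ,_) , Qall ∘ (true ,_))
                   (all? (Q? ∘ (false ,_)) ×-dec all? (Q? ∘ (true ,_)))

  wordOfLength? : ∀ L {Q : List (Gen m) → Set} → (∀ w → Dec (Q w)) → Dec (∃ λ w → length w ≡ L × Q w)
  wordOfLength? zero Q? with Q? []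
  ... | yes q = yes ([] , refl , q)
  ... | no ¬q = no λ { ([] , _ , q) → ¬q q }
  wordOfLength? (suc L) Q? with ∃-gen? (λ g → wordOfLength? L (Q? ∘ (g ∷_)))
  ... | yes (g , w , |w|≡L , q) = yes (g ∷ w , cong suc |w|≡L , q)
  ... | no none = no λ { (g ∷ w , |w|≡1+L , q) → none (g , w , suc-injective |w|≡1+L , q) }

  shorterWord? : ∀ N {Q : List (Gen m) → Set} → (∀ w → Dec (Q w)) → Dec (∃ λ w → length w < N × Q w)
  shorterWord? N Q? = map′ (λ { (i , w , |w|≡i , q) → w , subst (_< N) (sym |w|≡i) (toℕ<n i) , q })
                           (λ { (w , |w|<N , q) → fromℕ< |w|<N , w , sym (toℕ-fromℕ< |w|<N) , q })
                           (any? λ (i : Fin N) → wordOfLength? (toℕ i) Q?)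

  shortestWord : ∀ {Q : List (Gen m) → Set} → (∀ w → Dec (Q w)) → ∀ N w → length w ≤ N → Q w →
                 ∃ λ w′ → Q w′ × (∀ w″ → Q w″ → length w′ ≤ length w″)
  shortestWord Q? N w |w|≤N q with shorterWord? (length w) Q?
  ... | no none = w , q , λ w″ q″ → ≮⇒≥ λ |w″|<|w| → none (w″ , |w″|<|w| , q″)
  shortestWord Q? zero w |w|≤0 q | yes (_ , |w′|<|w| , _) = contradiction (≤-trans |w′|<|w| |w|≤0) λ ()
  shortestWord Q? (suc N) w |w|≤1+N q | yes (w′ , |w′|<|w| , q′) = shortestWord Q? N w′ (s≤s⁻¹ (≤-trans |w′|<|w| |w|≤1+N)) q′

  reducedExpression : ∀ {v} → IsSignedPerm v → ∃ λ w → Reduced w v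
  reducedExpression {v} v-perm =
    let w , _ , w≈v = isSignedPerm⇒word v-perm
    in shortestWord (λ w → ∀-spt? λ p → eval w p ≟ₚ v p) (length w) w ≤-refl w≈v

lemma4p2 : (m : ℕ) (J : GenSet m) (g : Gen m) (x v : SPt m → SPt m) →
    IsSignedPerm x → IsSignedPerm v →
    SameCoset J (λ p → v (act g (x p))) x →
    ¬ SameCoset J x (λ p → act g (x p)) →
    InRw g v
lemma4p2 m J g x v x-perm v-perm vgx∼x x≁gx with reducedExpression v-perm
... | w , w-reduced with Any.any? (g ≟ᵍ_) w
...   | yes g∈w = w , w-reduced , g∈w
...   | no g∉w = contradiction (labelInvariant⇒sameCoset J x-perm (act∘-isSignedPerm g x-perm) g-invariant) x≁gx
  where
    module X = SignedPerm x-perm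
    module V = SignedPerm v-perm
    lam : SPt m → ℕ × Bool
    lam = label J ∘ X.inverse
    vg-invariant : ∀ q → lam (v (act g q)) ≡ lam q
    vg-invariant q = trans (cong (λ r → lam (v (act g r))) (sym (X.inverse-right q)))
                           (sameCoset⇒labelInvariant J {y = λ p → v (act g (x p))} x-perm vgx∼x (X.inverse q))
    v-beyond : ∀ β q → Beyond g β q → Beyond g β (v q)
    v-beyond β q q-beyond = subst (Beyond g β) (proj₁ w-reduced q) (eval-preserves-beyond w g∉w β q q-beyond)
    g-invariant : ∀ p → label J (X.inverse (act g (x p))) ≡ label J p
    g-invariant p = trans (generator-invariant lam V.injective g v-beyond vg-invariant (x p)) (cong (label J) (X.inverse-left p))
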